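{- Let $t$ be a lambda-term in $\beta$-normal form. Then $[\![S]\!](t)=[\![S']\!](t)$ (syntactic identity).
   Context: Lambda-terms are considered up to $\alpha$-equivalence; $\mathrm{FV}(t)$ is the set of free variables of $t$. Fix the combinators $\mathsf{S}=\lambda xyz.xz(yz)$, $\mathsf{K}=\lambda xy.x$, $\mathsf{I}=\lambda x.x$, $\mathsf{B}=\lambda xyz.x(yz)$, $\mathsf{C}=\lambda xyz.xzy$, let $\mathcal{B}=\{\mathsf{S},\mathsf{K},\mathsf{I},\mathsf{B},\mathsf{C}\}$, and let $\mathrm{CL}(\mathcal{B})$ be the set of terms built from variables and elements of $\mathcal{B}$ using only application (left-associative); equality of such terms is syntactic, combinators treated as atoms. Sch\"onfinkel's algorithm $S$: for a variable $x$ and $t\in\mathrm{CL}(\mathcal{B})$, $[x]_S t$ is given by the first applicable equation: (1) $[x]_S t=\mathsf{K}t$ if $x\notin\mathrm{FV}(t)$; (2) $[x]_S x=\mathsf{I}$; (3) $[x]_S(sx)=s$ if $x\notin\mathrm{FV}(s)$; (4) $[x]_S(st)=\mathsf{B}s([x]_S t)$ if $x\notin\mathrm{FV}(s)$; (5) $[x]_S(st)=\mathsf{C}([x]_S s)t$ if $x\notin\mathrm{FV}(t)$; (6) $[x]_S(st)=\mathsf{S}([x]_S s)([x]_S t)$. Algorithm $S'$: $[x]_{S'}(st)=\mathrm{Opt}(\mathsf{S}([x]_{S'}s)([x]_{S'}t))$; $[x]_{S'}x=\mathsf{I}$; $[x]_{S'}t=\mathsf{K}t$ otherwise (for $t$ a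 variable other than $x$ or a constant), earlier equations taking precedence, where $\mathrm{Opt}$ is given by the first applicable clause: (1) $\mathrm{Opt}(\mathsf{S}(\mathsf{K}s)(\mathsf{K}t))=\mathsf{K}(st)$; (2) $\mathrm{Opt}(\mathsf{S}(\mathsf{K}s)\mathsf{I})=s$; (3) $\mathrm{Opt}(\mathsf{S}(\mathsf{K}s)t)=\mathsf{B}st$; (4) $\mathrm{Opt}(\mathsf{S}s(\mathsf{K}t))=\mathsf{C}st$; (5) $\mathrm{Opt}(\mathsf{S}st)=\mathsf{S}st$. For an abstraction algorithm $A$ the induced translation $[\![A]\!]$ from lambda-terms to $\mathrm{CL}(\mathcal{B})$ is defined by $[\![A]\!](x)=x$, $[\![A]\!](st)=[\![A]\!](s)\,[\![A]\!](t)$, $[\![A]\!](\lambda x.t)=[x]_A([\![A]\!](t))$. -}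

module Defs where

open import Data.Nat using (ℕ; _≡ᵇ_)
open import Data.Bool using (Bool; true; false; _∨_; if_then_else_)

-- The translations below do not depend on the choice of bound names,
-- so quantifying over all representatives is the same as quantifying
-- over alpha-equivalence classes.
data Λ : Set where
  var : ℕ → Λ
  app : Λ → Λ → Λ
  lam : ℕ → Λ → Λ

mutual
  data Neutral : Λ → Set where
    nvar : ∀ x → Neutral (var x)
    napp : ∀ {s u} → Neutral s → Normal u → Neutral (app s u)

  data Normal : Λ → Set where
    neu : ∀ {t} → Neutral t → Normal t
    nlam : ∀ x {t} → Normal t → Normal (lam x t)

infixl 9 _·_
data CL : Set where
  v : ℕ → CL
  `S `K `I `B `C : CL
  _·_ : CL → CL → CL

occurs : ℕ → CL → Bool
occurs x (v y) = x ≡ᵇ y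
occurs x `S = false
occurs x `K = false
occurs x `I = false
occurs x `B = false
occurs x `C = false
occurs x (s · u) = occurs x s ∨ occurs x u

isVar : ℕ → CL → Bool
isVar x (v y) = x ≡ᵇ y
isVar x _ = false

absS : ℕ → CL → CL
absS x t with occurs x t
... | false = `K · t                                  -- (1)
absS x (v y) | true = `I                               -- (2)
absS x (s · u) | true with occurs x s
... | false = if isVar x u then s                     -- (3)
              else `B · s · absS x u                   -- (4)
... | true with occurs x u
...   | false = `C · absS x s · u                      -- (5)
...   | true  = `S · absS x s · absS x u               -- (6)
absS x t | true = `K · t  -- unreachable: x cannot occur in a constant

-- Opt s t  stands for  Opt(S s t)
Opt : CL → CL → CL
Opt (`K · s) (`K · t) = `K · (s · t)   -- (1)
Opt (`K · s) `I = s                    -- (2)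
Opt (`K · s) t = `B · s · t            -- (3)
Opt s (`K · t) = `C · s · t            -- (4)
Opt s t = `S · s · t                   -- (5)

absS' : ℕ → CL → CL
absS' x (s · u) = Opt (absS' x s) (absS' x u)
absS' x (v y) = if x ≡ᵇ y then `I else `K · v y
absS' x t = `K · t

⟦_⟧ : (ℕ → CL → CL) → Λ → CL
⟦ A ⟧ (var x) = v x
⟦ A ⟧ (app s u) = ⟦ A ⟧ s · ⟦ A ⟧ u
⟦ A ⟧ (lam x t) = A x (⟦ A ⟧ t)

module Submission where

-- The S-translation of a β-normal form contains neither an I-redex I a nor a
-- K-redex K a b, and Schönfinkel abstraction preserves this.  For such a t in
-- which x occurs, [x]_S t is never of the form K a, and it is I only when t is
-- x itself.  These are exactly the side conditions under which Opt, applied to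
-- the abstractions of the two halves of an application, selects the clause that
-- reproduces the equation of S used for it: Opt (2) for η, (3) for B, (4) for C and
-- (5) for S; terms in which x does not occur go to K t under both algorithms.

open import Defs
open import Data.Bool using (true; false; T)
open import Data.Empty using (⊥-elim)
open import Data.Nat using (ℕ; zero; suc; _≡ᵇ_)
open import Data.Nat.Properties using (≡ᵇ⇒≡)
open import Data.Product using (_×_; _,_)
open import Data.Unit using (⊤)
open import Relation.Nullary using (¬_)
open import Relation.Binary.PropositionalEquality
  using (_≡_; _≢_; refl; sym; trans; cong; cong₂; subst; module ≡-Reasoning)

open ≡-Reasoning

≡ᵇ-refl : ∀ n → (n ≡ᵇ n) ≡ true
≡ᵇ-refl zero = refl
≡ᵇ-refl (suc n) = ≡ᵇ-refl n

isVar-true⇒≡ : ∀ {x} u → isVar x u ≡ true → u ≡ v x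
isVar-true⇒≡ {x} (v y) e = cong v (sym (≡ᵇ⇒≡ x y (subst T (sym e) _)))

isVar-false⇒≢ : ∀ {x u} → isVar x u ≡ false → u ≢ v x
isVar-false⇒≢ {x} e refl with () ← trans (sym e) (≡ᵇ-refl x)

data IKHead : CL → Set where
  I-head : IKHead `I
  K-head : ∀ a → IKHead (`K · a)

IKNormal : CL → Set
IKNormal (s · u) = ¬ IKHead s × IKNormal s × IKNormal u
IKNormal _ = ⊤

NotKApp : CL → Set
NotKApp r = ∀ a → r ≢ `K · a

¬IKHead⇒NotKApp : ∀ {r} → ¬ IKHead r → NotKApp r
¬IKHead⇒NotKApp ¬h a refl = ¬h (K-head a)

-- Opt computes only after its arguments are split into these twelve shapes.
notKApp-elim : (P : CL → Set) → ∀ r → NotKApp r →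
  (∀ {y} → P (v y)) → P `S → P `K → P `I → P `B → P `C →
  (∀ {y b} → P (v y · b)) → (∀ {b} → P (`S · b)) → (∀ {b} → P (`I · b)) →
  (∀ {b} → P (`B · b)) → (∀ {b} → P (`C · b)) → (∀ {a a' b} → P (a · a' · b)) →
  P r
notKApp-elim P r ¬k pv pS pK pI pB pC pv· pS· pI· pB· pC· p·· = go r ¬k
  where
  go : ∀ r → NotKApp r → P r
  go (v y) _ = pv
  go `S _ = pS
  go `K _ = pK
  go `I _ = pI
  go `B _ = pB
  go `C _ = pC
  go (v y · b) _ = pv·
  go (`S · b) _ = pS·
  go (`K · b) ¬k = ⊥-elim (¬k b refl)
  go (`I · b) _ = pI·
  go (`B · b) _ = pB·
  go (`C · b) _ = pC·
  go (a · a' · b) _ = p··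

Opt-B : ∀ s q → ¬ IKHead q → Opt (`K · s) q ≡ `B · s · q
Opt-B s q ¬h = notKApp-elim (λ q → q ≢ `I → Opt (`K · s) q ≡ `B · s · q) q (¬IKHead⇒NotKApp ¬h)
  (λ _ → refl) (λ _ → refl) (λ _ → refl) (λ q≢I → ⊥-elim (q≢I refl)) (λ _ → refl) (λ _ → refl)
  (λ _ → refl) (λ _ → refl) (λ _ → refl) (λ _ → refl) (λ _ → refl) (λ _ → refl)
  (λ { refl → ¬h I-head })

Opt-C : ∀ r u → NotKApp r → Opt r (`K · u) ≡ `C · r · u
Opt-C r u ¬r = notKApp-elim (λ r → Opt r (`K · u) ≡ `C · r · u) r ¬r
  refl refl refl refl refl refl refl refl refl refl refl refl

Opt-S : ∀ r q → NotKApp r → NotKApp q → Opt r q ≡ `S · r · q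
Opt-S r q ¬r ¬q = notKApp-elim (λ r → OptIsS r q) r ¬r
  (notKApp-elim (OptIsS _) q ¬q refl refl refl refl refl refl refl refl refl refl refl refl)
  (notKApp-elim (OptIsS _) q ¬q refl refl refl refl refl refl refl refl refl refl refl refl)
  (notKApp-elim (OptIsS _) q ¬q refl refl refl refl refl refl refl refl refl refl refl refl)
  (notKApp-elim (OptIsS _) q ¬q refl refl refl refl refl refl refl refl refl refl refl refl)
  (notKApp-elim (OptIsS _) q ¬q refl refl refl refl refl refl refl refl refl refl refl refl)
  (notKApp-elim (OptIsS _) q ¬q refl refl refl refl refl refl refl refl refl refl refl refl)
  (notKApp-elim (OptIsS _) q ¬q refl refl refl refl refl refl refl refl refl refl refl refl)
  (notKApp-elim (OptIsS _) q ¬q refl refl refl refl refl refl refl refl refl refl refl refl)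
  (notKApp-elim (OptIsS _) q ¬q refl refl refl refl refl refl refl refl refl refl refl refl)
  (notKApp-elim (OptIsS _) q ¬q refl refl refl refl refl refl refl refl refl refl refl refl)
  (notKApp-elim (OptIsS _) q ¬q refl refl refl refl refl refl refl refl refl refl refl refl)
  (notKApp-elim (OptIsS _) q ¬q refl refl refl refl refl refl refl refl refl refl refl refl)
  where
  OptIsS : CL → CL → Set
  OptIsS r q = Opt r q ≡ `S · r · q

-- AbsS x t r: x occurs in t and r = [x]_S t, one constructor per equation (2)–(6).
data AbsS (x : ℕ) : CL → CL → Set where
  var : AbsS x (v x) `I
  eta : ∀ {s} → occurs x s ≡ false → AbsS x (s · v x) s
  B : ∀ {s u r} → occurs x s ≡ false → u ≢ v x → AbsS x u r → AbsS x (s · u) (`B · s · r)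
  C : ∀ {s u r} → AbsS x s r → occurs x u ≡ false → AbsS x (s · u) (`C · r · u)
  S : ∀ {s u r q} → AbsS x s r → AbsS x u q → AbsS x (s · u) (`S · r · q)

absS-graph : ∀ x t → occurs x t ≡ true → AbsS x t (absS x t)
absS-graph x (v y) o rewrite o | isVar-true⇒≡ (v y) o = var
absS-graph x (s · u) o with occurs x s in es | occurs x u in eu
... | false | true rewrite es with isVar x u in ev
...   | true rewrite isVar-true⇒≡ u ev = eta es
...   | false = B es (isVar-false⇒≢ ev) (absS-graph x u eu)
absS-graph x (s · u) o | true | false rewrite es | eu = C (absS-graph x s es) eu
absS-graph x (s · u) o | true | true rewrite es | eu = S (absS-graph x s es) (absS-graph x u eu)

absS'-fresh : ∀ x t → occurs x t ≡ false → absS' x t ≡ `K · t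
absS'-fresh x (v y) e rewrite e = refl
absS'-fresh x `S e = refl
absS'-fresh x `K e = refl
absS'-fresh x `I e = refl
absS'-fresh x `B e = refl
absS'-fresh x `C e = refl
absS'-fresh x (s · u) e with occurs x s in es | occurs x u in eu
... | false | false rewrite absS'-fresh x s es | absS'-fresh x u eu = refl

absS'-var : ∀ x → absS' x (v x) ≡ `I
absS'-var x rewrite ≡ᵇ-refl x = refl

AbsS-NotKApp : ∀ {x t r} → AbsS x t r → IKNormal t → NotKApp r
AbsS-NotKApp var _ _ ()
AbsS-NotKApp (eta _) (¬h , _) = ¬IKHead⇒NotKApp ¬h
AbsS-NotKApp (B _ _ _) _ _ ()
AbsS-NotKApp (C _ _) _ _ ()
AbsS-NotKApp (S _ _) _ _ ()

AbsS-IKHead⇒var : ∀ {x t r} → AbsS x t r → IKNormal t → IKHead r → t ≡ v x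
AbsS-IKHead⇒var var _ _ = refl
AbsS-IKHead⇒var (eta _) (¬h , _) h = ⊥-elim (¬h h)

AbsS-IKNormal : ∀ {x t r} → AbsS x t r → IKNormal t → IKNormal r
AbsS-IKNormal var _ = _
AbsS-IKNormal (eta _) (_ , ns , _) = ns
AbsS-IKNormal (B _ _ d) (_ , ns , nu) = (λ ()) , ((λ ()) , _ , ns) , AbsS-IKNormal d nu
AbsS-IKNormal (C d _) (_ , ns , nu) = (λ ()) , ((λ ()) , _ , AbsS-IKNormal d ns) , nu
AbsS-IKNormal (S d e) (_ , ns , nu) = (λ ()) , ((λ ()) , _ , AbsS-IKNormal d ns) , AbsS-IKNormal e nu

AbsS⇒≡absS' : ∀ {x t r} → AbsS x t r → IKNormal t → r ≡ absS' x t
AbsS⇒≡absS' {x} var _ = sym (absS'-var x)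
AbsS⇒≡absS' {x} (eta {s} x∉s) _ = sym (cong₂ Opt (absS'-fresh x s x∉s) (absS'-var x))
AbsS⇒≡absS' {x} (B {s} {u} {r} x∉s u≢x d) (_ , _ , nu) = begin
  `B · s · r                    ≡⟨ sym (Opt-B s r (λ h → u≢x (AbsS-IKHead⇒var d nu h))) ⟩
  Opt (`K · s) r                ≡⟨ cong₂ Opt (sym (absS'-fresh x s x∉s)) (AbsS⇒≡absS' d nu) ⟩
  Opt (absS' x s) (absS' x u)   ∎
AbsS⇒≡absS' {x} (C {s} {u} {r} d x∉u) (_ , ns , _) = begin
  `C · r · u                    ≡⟨ sym (Opt-C r u (AbsS-NotKApp d ns)) ⟩
  Opt r (`K · u)                ≡⟨ cong₂ Opt (AbsS⇒≡absS' d ns) (sym (absS'-fresh x u x∉u)) ⟩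
  Opt (absS' x s) (absS' x u)   ∎
AbsS⇒≡absS' {x} (S {s} {u} {r} {q} d e) (_ , ns , nu) = begin
  `S · r · q                    ≡⟨ sym (Opt-S r q (AbsS-NotKApp d ns) (AbsS-NotKApp e nu)) ⟩
  Opt r q                       ≡⟨ cong₂ Opt (AbsS⇒≡absS' d ns) (AbsS⇒≡absS' e nu) ⟩
  Opt (absS' x s) (absS' x u)   ∎

absS-IKNormal : ∀ x t → IKNormal t → IKNormal (absS x t)
-- Abstracting occurs x t in the type of absS-graph x t too lets it agree with
-- the `with` inside absS.
absS-IKNormal x t nt with occurs x t | absS-graph x t
... | false | _ = (λ ()) , _ , nt
... | true | graph = AbsS-IKNormal (graph refl) nt

absS≡absS' : ∀ x t → IKNormal t → absS x t ≡ absS' x t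
absS≡absS' x t nt with occurs x t in o | absS-graph x t
... | false | _ = sym (absS'-fresh x t o)
... | true | graph = AbsS⇒≡absS' (graph refl) nt

Neutral-¬IKHead : ∀ {A t} → Neutral t → ¬ IKHead (⟦ A ⟧ t)
Neutral-¬IKHead (nvar x) ()
Neutral-¬IKHead (napp (nvar _) _) ()
Neutral-¬IKHead (napp (napp _ _) _) ()

mutual
  Normal-IKNormal : ∀ {t} → Normal t → IKNormal (⟦ absS ⟧ t)
  Normal-IKNormal (neu n) = Neutral-IKNormal n
  Normal-IKNormal (nlam x {t} n) = absS-IKNormal x (⟦ absS ⟧ t) (Normal-IKNormal n)

  Neutral-IKNormal : ∀ {t} → Neutral t → IKNormal (⟦ absS ⟧ t)
  Neutral-IKNormal (nvar x) = _
  Neutral-IKNormal (napp s u) = Neutral-¬IKHead s , Neutral-IKNormal s , Normal-IKNormal u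

mutual
  mainTheorem4 : (t : Λ) → Normal t → ⟦ absS ⟧ t ≡ ⟦ absS' ⟧ t
  mainTheorem4 t (neu n) = Neutral-⟦absS⟧≡⟦absS'⟧ n
  mainTheorem4 (lam x t) (nlam .x n) = begin
    absS x (⟦ absS ⟧ t)     ≡⟨ absS≡absS' x (⟦ absS ⟧ t) (Normal-IKNormal n) ⟩
    absS' x (⟦ absS ⟧ t)    ≡⟨ cong (absS' x) (mainTheorem4 t n) ⟩
    absS' x (⟦ absS' ⟧ t)   ∎

  Neutral-⟦absS⟧≡⟦absS'⟧ : ∀ {t} → Neutral t → ⟦ absS ⟧ t ≡ ⟦ absS' ⟧ t
  Neutral-⟦absS⟧≡⟦absS'⟧ (nvar x) = refl
  Neutral-⟦absS⟧≡⟦absS'⟧ (napp {u = u} ns nu) = cong₂ _·_ (Neutral-⟦absS⟧≡⟦absS'⟧ ns) (mainTheorem4 u nu)
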